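{- Let $\Theta$ be a System $\mathsf{F}_\wedge$ context, $S,S'$ types and $t$ a term such that $\Theta,X<:S\vdash t:T$ and $\Theta\vdash S'<:S$. Then the equation $\Theta\vdash(\Lambda X.\,t[X\wedge S/X])\{S'\}=t[S'/X]:T[S'/X]$ is derivable in the equational theory of System $\mathsf{F}_\wedge$.
   Context: System $\mathsf{F}_\wedge$. Types: $T ::= \top\mid X\mid T\to T\mid \forall X.T\mid T\wedge T$ (up to $\alpha$-conversion). Contexts $\Theta$ are finite sequences of assumptions $X<:T$ and $x:T$ ($T$ any $\mathsf{F}_\wedge$-type), with the usual well-formedness judgment $\Theta\vdash T$ (including $\Theta\vdash S\wedge T$ from $\Theta\vdash S,T$ and $\Theta\vdash\forall X.T$ from $\Theta,X<:\top\vdash T$). Subtyping $\Theta\vdash S<:T$ is generated by: (Var) $\Theta,X<:T,\Theta'\vdash X<:T$; (Top) $\Theta\vdash T<:\top$; (Refl); (Trans); ($\to$) contravariant in domain, covariant in codomain; ($\forall$) from $\Theta,X<:\top\vdash S<:T$ infer $\Theta\vdash\forall X.S<:\forall X.T$; $\Theta\vdash S\wedge S'<:S$; $\Theta\vdash S\wedge S'<:S'$; from $\Theta\vdash T<:S$ and $\Theta\vdash T<:S'$ infer $\Theta\vdash T<:S\wedge S'$. Terms: $t ::= \mathsf{top}\mid x\mid\lambda(x:T).t\mid\Lambda X.t\mid t\,t\mid t\{T\}$. Typing: $\Theta\vdash\mathsf{top}:\top$; $\Theta,x:T,\Theta'\vdash x:T$; subsumption; $\lambda$-introduction and application as usual;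 from $\Theta,X<:\top\vdash t:T$ infer $\Theta\vdash\Lambda X.t:\forall X.T$; from $\Theta\vdash t:\forall X.T$ and $\Theta\vdash S'$ infer $\Theta\vdash t\{S'\}:T[S'/X]$. Equational judgments $\Theta\vdash t=t':T$ (where $\Theta\vdash t:T$ and $\Theta\vdash t':T$) are generated by: any two terms of type $\top$ are equal at $\top$; reflexivity, symmetry, transitivity; $\beta_1$: $\Theta\vdash(\lambda x.t)\,s=t[s/x]:T$ when $\Theta,x:S\vdash t:T$, $\Theta\vdash s:S$; $\eta_1$: $\Theta\vdash\lambda x.(t\,x)=t:S\to T$ for $\Theta\vdash t:S\to T$, $x\notin\mathrm{dom}(\Theta)$; $\beta_2$: $\Theta\vdash(\Lambda X.t)\{R\}=t[R/X]:T[R/X]$ when $\Theta,X<:\top\vdash t:T$; $\eta_2$: $\Theta\vdash\Lambda Y.(t\{Y\})=t:\forall X.T$ for $\Theta\vdash t:\forall X.T$, $Y\notin\mathrm{dom}(\Theta)$; congruence for $\lambda$, for $\Lambda$ (from $\Theta,X<:\top\vdash t=t':T$ infer $\Theta\vdash\Lambda X.t=\Lambda X.t':\forall X.T$) and for application; $\mathit{app}_2$: from $\Theta\vdash t=t':\forall X.T$, $\Theta\vdash T[R/X]<:T'$ and $\Theta\vdash T[R'/X]<:T'$ (with $R,R'$ well-formed) infer $\Theta\vdash t\{R\}=t'\{R'\}:T'$. Substitution $t[S/X]$, $T[S/X]$ is capture-avoiding. -}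

module Defs where

open import Data.Nat using (ℕ; zero; suc)
open import Data.Product using (∃)

-- Type variables and term variables live in separate index spaces:
-- a type-variable index n refers to the n-th type-variable assumption
-- (X <: T) counted from the right of the context; a term-variable index
-- refers to the n-th term assumption (x : T) counted from the right.

infixr 7 _⇒_
infixl 8 _∧_

data Ty : Set where
  ⊤'   : Ty
  tvar : ℕ → Ty
  _⇒_  : Ty → Ty → Ty
  ∀'   : Ty → Ty
  _∧_  : Ty → Ty → Ty

extR : (ℕ → ℕ) → ℕ → ℕ
extR ρ zero    = zero
extR ρ (suc n) = suc (ρ n)

renTy : (ℕ → ℕ) → Ty → Ty
renTy ρ ⊤'       = ⊤'
renTy ρ (tvar n) = tvar (ρ n)
renTy ρ (S ⇒ T)  = renTy ρ S ⇒ renTy ρ T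
renTy ρ (∀' T)   = ∀' (renTy (extR ρ) T)
renTy ρ (S ∧ T)  = renTy ρ S ∧ renTy ρ T

wkTy : Ty → Ty
wkTy = renTy suc

extS : (ℕ → Ty) → ℕ → Ty
extS σ zero    = tvar zero
extS σ (suc n) = wkTy (σ n)

subTy : (ℕ → Ty) → Ty → Ty
subTy σ ⊤'       = ⊤'
subTy σ (tvar n) = σ n
subTy σ (S ⇒ T)  = subTy σ S ⇒ subTy σ T
subTy σ (∀' T)   = ∀' (subTy (extS σ) T)
subTy σ (S ∧ T)  = subTy σ S ∧ subTy σ T

_•_ : {A : Set} → A → (ℕ → A) → ℕ → A
(a • σ) zero    = a
(a • σ) (suc n) = σ n

_[_]ᵀ : Ty → Ty → Ty
T [ S ]ᵀ = subTy (S • tvar) T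

data Tm : Set where
  top  : Tm
  var  : ℕ → Tm
  lam  : Ty → Tm → Tm
  Lam  : Tm → Tm
  app  : Tm → Tm → Tm
  tapp : Tm → Ty → Tm

subTmTy : (ℕ → Ty) → Tm → Tm
subTmTy σ top        = top
subTmTy σ (var n)    = var n
subTmTy σ (lam T t)  = lam (subTy σ T) (subTmTy σ t)
subTmTy σ (Lam t)    = Lam (subTmTy (extS σ) t)
subTmTy σ (app t s)  = app (subTmTy σ t) (subTmTy σ s)
subTmTy σ (tapp t T) = tapp (subTmTy σ t) (subTy σ T)

wkTmTy : Tm → Tm
wkTmTy = subTmTy (λ n → tvar (suc n))

_[_]ᵗᵀ : Tm → Ty → Tm
t [ S ]ᵗᵀ = subTmTy (S • tvar) t

renTm : (ℕ → ℕ) → Tm → Tm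
renTm ρ top        = top
renTm ρ (var n)    = var (ρ n)
renTm ρ (lam T t)  = lam T (renTm (extR ρ) t)
renTm ρ (Lam t)    = Lam (renTm ρ t)
renTm ρ (app t s)  = app (renTm ρ t) (renTm ρ s)
renTm ρ (tapp t T) = tapp (renTm ρ t) T

wkTm : Tm → Tm
wkTm = renTm suc

extTm : (ℕ → Tm) → ℕ → Tm
extTm σ zero    = var zero
extTm σ (suc n) = wkTm (σ n)

subTm : (ℕ → Tm) → Tm → Tm
subTm σ top        = top
subTm σ (var n)    = σ n
subTm σ (lam T t)  = lam T (subTm (extTm σ) t)
subTm σ (Lam t)    = Lam (subTm (λ n → wkTmTy (σ n)) t)
subTm σ (app t s)  = app (subTm σ t) (subTm σ s)
subTm σ (tapp t T) = tapp (subTm σ t) T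

_[_]ᵗ : Tm → Tm → Tm
t [ s ]ᵗ = subTm (s • var) t

infixl 5 _,<:_ _,∶_

data Ctx : Set where
  ∅     : Ctx
  _,<:_ : Ctx → Ty → Ctx
  _,∶_  : Ctx → Ty → Ctx

-- Θ ∋ X_n <: T   (T expressed relative to the whole of Θ)
data _∋tv_<:_ : Ctx → ℕ → Ty → Set where
  here    : ∀ {Θ T} → (Θ ,<: T) ∋tv zero <: wkTy T
  thereTV : ∀ {Θ n T S} → Θ ∋tv n <: T → (Θ ,<: S) ∋tv suc n <: wkTy T
  thereV  : ∀ {Θ n T S} → Θ ∋tv n <: T → (Θ ,∶ S) ∋tv n <: T

data _∋v_∶_ : Ctx → ℕ → Ty → Set where
  here    : ∀ {Θ T} → (Θ ,∶ T) ∋v zero ∶ T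
  thereV  : ∀ {Θ n T S} → Θ ∋v n ∶ T → (Θ ,∶ S) ∋v suc n ∶ T
  thereTV : ∀ {Θ n T S} → Θ ∋v n ∶ T → (Θ ,<: S) ∋v n ∶ wkTy T

data _⊢wf_ : Ctx → Ty → Set where
  wf-top : ∀ {Θ} → Θ ⊢wf ⊤'
  wf-var : ∀ {Θ n} → ∃ (λ U → Θ ∋tv n <: U) → Θ ⊢wf tvar n
  wf-⇒   : ∀ {Θ S T} → Θ ⊢wf S → Θ ⊢wf T → Θ ⊢wf (S ⇒ T)
  wf-∀   : ∀ {Θ T} → (Θ ,<: ⊤') ⊢wf T → Θ ⊢wf ∀' T
  wf-∧   : ∀ {Θ S T} → Θ ⊢wf S → Θ ⊢wf T → Θ ⊢wf (S ∧ T)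

data _⊢_<:_ : Ctx → Ty → Ty → Set where
  S-var   : ∀ {Θ n T} → Θ ∋tv n <: T → Θ ⊢ tvar n <: T
  S-top   : ∀ {Θ T} → Θ ⊢ T <: ⊤'
  S-refl  : ∀ {Θ T} → Θ ⊢ T <: T
  S-trans : ∀ {Θ S U T} → Θ ⊢ S <: U → Θ ⊢ U <: T → Θ ⊢ S <: T
  S-⇒     : ∀ {Θ S S' T T'} → Θ ⊢ S' <: S → Θ ⊢ T <: T' → Θ ⊢ (S ⇒ T) <: (S' ⇒ T')
  S-∀     : ∀ {Θ S T} → (Θ ,<: ⊤') ⊢ S <: T → Θ ⊢ ∀' S <: ∀' T
  S-∧l    : ∀ {Θ S S'} → Θ ⊢ (S ∧ S') <: S
  S-∧r    : ∀ {Θ S S'} → Θ ⊢ (S ∧ S') <: S'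
  S-∧     : ∀ {Θ T S S'} → Θ ⊢ T <: S → Θ ⊢ T <: S' → Θ ⊢ T <: (S ∧ S')

data _⊢_∶_ : Ctx → Tm → Ty → Set where
  T-top  : ∀ {Θ} → Θ ⊢ top ∶ ⊤'
  T-var  : ∀ {Θ n T} → Θ ∋v n ∶ T → Θ ⊢ var n ∶ T
  T-sub  : ∀ {Θ t S T} → Θ ⊢ t ∶ S → Θ ⊢ S <: T → Θ ⊢ t ∶ T
  T-lam  : ∀ {Θ t S T} → (Θ ,∶ S) ⊢ t ∶ T → Θ ⊢ lam S t ∶ (S ⇒ T)
  T-app  : ∀ {Θ t s S T} → Θ ⊢ t ∶ (S ⇒ T) → Θ ⊢ s ∶ S → Θ ⊢ app t s ∶ T
  T-Lam  : ∀ {Θ t T} → (Θ ,<: ⊤') ⊢ t ∶ T → Θ ⊢ Lam t ∶ ∀' T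
  T-tapp : ∀ {Θ t T S'} → Θ ⊢ t ∶ ∀' T → Θ ⊢wf S' → Θ ⊢ tapp t S' ∶ (T [ S' ]ᵀ)

data _⊢_≡_∶_ : Ctx → Tm → Tm → Ty → Set where
  E-top   : ∀ {Θ t t'} → Θ ⊢ t ∶ ⊤' → Θ ⊢ t' ∶ ⊤' → Θ ⊢ t ≡ t' ∶ ⊤'
  E-refl  : ∀ {Θ t T} → Θ ⊢ t ∶ T → Θ ⊢ t ≡ t ∶ T
  E-sym   : ∀ {Θ t t' T} → Θ ⊢ t ≡ t' ∶ T → Θ ⊢ t' ≡ t ∶ T
  E-trans : ∀ {Θ t t' t'' T} → Θ ⊢ t ≡ t' ∶ T → Θ ⊢ t' ≡ t'' ∶ T → Θ ⊢ t ≡ t'' ∶ T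
  E-β₁    : ∀ {Θ S T t s} → (Θ ,∶ S) ⊢ t ∶ T → Θ ⊢ s ∶ S →
            Θ ⊢ app (lam S t) s ≡ (t [ s ]ᵗ) ∶ T
  E-η₁    : ∀ {Θ S T t} → Θ ⊢ t ∶ (S ⇒ T) →
            Θ ⊢ lam S (app (wkTm t) (var zero)) ≡ t ∶ (S ⇒ T)
  E-β₂    : ∀ {Θ t T R} → (Θ ,<: ⊤') ⊢ t ∶ T → Θ ⊢wf R →
            Θ ⊢ tapp (Lam t) R ≡ (t [ R ]ᵗᵀ) ∶ (T [ R ]ᵀ)
  E-η₂    : ∀ {Θ t T} → Θ ⊢ t ∶ ∀' T →
            Θ ⊢ Lam (tapp (wkTmTy t) (tvar zero)) ≡ t ∶ ∀' T
  E-lam   : ∀ {Θ S T t t'} → (Θ ,∶ S) ⊢ t ≡ t' ∶ T → Θ ⊢ lam S t ≡ lam S t' ∶ (S ⇒ T)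
  E-Lam   : ∀ {Θ T t t'} → (Θ ,<: ⊤') ⊢ t ≡ t' ∶ T → Θ ⊢ Lam t ≡ Lam t' ∶ ∀' T
  E-app   : ∀ {Θ S T t t' s s'} → Θ ⊢ t ≡ t' ∶ (S ⇒ T) → Θ ⊢ s ≡ s' ∶ S →
            Θ ⊢ app t s ≡ app t' s' ∶ T
  E-app₂  : ∀ {Θ T T' t t' R R'} → Θ ⊢ t ≡ t' ∶ ∀' T →
            Θ ⊢wf R → Θ ⊢wf R' →
            Θ ⊢ (T [ R ]ᵀ) <: T' → Θ ⊢ (T [ R' ]ᵀ) <: T' →
            Θ ⊢ tapp t R ≡ tapp t' R' ∶ T'

-- t [X ∧ S / X] where t lives in Θ , X <: S and the result in Θ , X <: ⊤
-- (type variable 0 is X; S is weakened past the binder for X)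
_[X∧_/X] : Tm → Ty → Tm
t [X∧ S /X] = subTmTy ((tvar zero ∧ wkTy S) • (λ n → tvar (suc n))) t

-- β₂ turns the left-hand side into t[S' ∧ S / X]. Since S' <: S, the types S' ∧ S and S' are
-- subtypes of each other, and substituting mutually-subtype types into a well-typed term gives
-- provably equal terms. That last fact is proved by induction on the typing derivation: where the
-- two substitutions disagree on a λ-annotation, η₁ and β₁ re-annotate the abstraction, and an
-- equation is moved along subsumption by applying the identity function at the larger type.
module Submission where

open import Defs
open import Data.Nat using (ℕ; zero; suc)
open import Data.Product using (Σ-syntax; _,_; _×_)
open import Function using (_∘_)
open import Relation.Binary.PropositionalEquality
  using (refl; sym; trans; cong; cong₂; subst; subst₂; _≗_) renaming (_≡_ to _≣_)

-- Substitution algebra on types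

extR-cong : ∀ {ρ ρ'} → ρ ≗ ρ' → extR ρ ≗ extR ρ'
extR-cong eq zero    = refl
extR-cong eq (suc n) = cong suc (eq n)

renTy-cong : ∀ {ρ ρ'} → ρ ≗ ρ' → renTy ρ ≗ renTy ρ'
renTy-cong eq ⊤'       = refl
renTy-cong eq (tvar n) = cong tvar (eq n)
renTy-cong eq (S ⇒ T)  = cong₂ _⇒_ (renTy-cong eq S) (renTy-cong eq T)
renTy-cong eq (∀' T)   = cong ∀' (renTy-cong (extR-cong eq) T)
renTy-cong eq (S ∧ T)  = cong₂ _∧_ (renTy-cong eq S) (renTy-cong eq T)

extS-cong : ∀ {σ σ'} → σ ≗ σ' → extS σ ≗ extS σ'
extS-cong eq zero    = refl
extS-cong eq (suc n) = cong wkTy (eq n)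

subTy-cong : ∀ {σ σ'} → σ ≗ σ' → subTy σ ≗ subTy σ'
subTy-cong eq ⊤'       = refl
subTy-cong eq (tvar n) = eq n
subTy-cong eq (S ⇒ T)  = cong₂ _⇒_ (subTy-cong eq S) (subTy-cong eq T)
subTy-cong eq (∀' T)   = cong ∀' (subTy-cong (extS-cong eq) T)
subTy-cong eq (S ∧ T)  = cong₂ _∧_ (subTy-cong eq S) (subTy-cong eq T)

extR-∘ : ∀ ρ ρ' → extR ρ ∘ extR ρ' ≗ extR (ρ ∘ ρ')
extR-∘ ρ ρ' zero    = refl
extR-∘ ρ ρ' (suc n) = refl

renTy-renTy : ∀ ρ ρ' T → renTy ρ (renTy ρ' T) ≣ renTy (ρ ∘ ρ') T
renTy-renTy ρ ρ' ⊤'       = refl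
renTy-renTy ρ ρ' (tvar n) = refl
renTy-renTy ρ ρ' (S ⇒ T)  = cong₂ _⇒_ (renTy-renTy ρ ρ' S) (renTy-renTy ρ ρ' T)
renTy-renTy ρ ρ' (∀' T)   =
  cong ∀' (trans (renTy-renTy (extR ρ) (extR ρ') T) (renTy-cong (extR-∘ ρ ρ') T))
renTy-renTy ρ ρ' (S ∧ T)  = cong₂ _∧_ (renTy-renTy ρ ρ' S) (renTy-renTy ρ ρ' T)

renTy-extR-wkTy : ∀ ρ U → renTy (extR ρ) (wkTy U) ≣ wkTy (renTy ρ U)
renTy-extR-wkTy ρ U = trans (renTy-renTy (extR ρ) suc U) (sym (renTy-renTy suc ρ U))

extS-extR : ∀ σ ρ → extS σ ∘ extR ρ ≗ extS (σ ∘ ρ)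
extS-extR σ ρ zero    = refl
extS-extR σ ρ (suc n) = refl

subTy-renTy : ∀ σ ρ T → subTy σ (renTy ρ T) ≣ subTy (σ ∘ ρ) T
subTy-renTy σ ρ ⊤'       = refl
subTy-renTy σ ρ (tvar n) = refl
subTy-renTy σ ρ (S ⇒ T)  = cong₂ _⇒_ (subTy-renTy σ ρ S) (subTy-renTy σ ρ T)
subTy-renTy σ ρ (∀' T)   =
  cong ∀' (trans (subTy-renTy (extS σ) (extR ρ) T) (subTy-cong (extS-extR σ ρ) T))
subTy-renTy σ ρ (S ∧ T)  = cong₂ _∧_ (subTy-renTy σ ρ S) (subTy-renTy σ ρ T)

renTy-extS : ∀ ρ σ → renTy (extR ρ) ∘ extS σ ≗ extS (renTy ρ ∘ σ)
renTy-extS ρ σ zero    = refl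
renTy-extS ρ σ (suc n) = renTy-extR-wkTy ρ (σ n)

renTy-subTy : ∀ ρ σ T → renTy ρ (subTy σ T) ≣ subTy (renTy ρ ∘ σ) T
renTy-subTy ρ σ ⊤'       = refl
renTy-subTy ρ σ (tvar n) = refl
renTy-subTy ρ σ (S ⇒ T)  = cong₂ _⇒_ (renTy-subTy ρ σ S) (renTy-subTy ρ σ T)
renTy-subTy ρ σ (∀' T)   =
  cong ∀' (trans (renTy-subTy (extR ρ) (extS σ) T) (subTy-cong (renTy-extS ρ σ) T))
renTy-subTy ρ σ (S ∧ T)  = cong₂ _∧_ (renTy-subTy ρ σ S) (renTy-subTy ρ σ T)

subTy-•-wkTy : ∀ a σ U → subTy (a • σ) (wkTy U) ≣ subTy σ U
subTy-•-wkTy a σ = subTy-renTy (a • σ) suc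

subTy-extS-wkTy : ∀ σ U → subTy (extS σ) (wkTy U) ≣ wkTy (subTy σ U)
subTy-extS-wkTy σ U = trans (subTy-renTy (extS σ) suc U) (sym (renTy-subTy suc σ U))

subTy-extS : ∀ σ τ → subTy (extS σ) ∘ extS τ ≗ extS (subTy σ ∘ τ)
subTy-extS σ τ zero    = refl
subTy-extS σ τ (suc n) = subTy-extS-wkTy σ (τ n)

subTy-subTy : ∀ σ τ T → subTy σ (subTy τ T) ≣ subTy (subTy σ ∘ τ) T
subTy-subTy σ τ ⊤'       = refl
subTy-subTy σ τ (tvar n) = refl
subTy-subTy σ τ (S ⇒ T)  = cong₂ _⇒_ (subTy-subTy σ τ S) (subTy-subTy σ τ T)
subTy-subTy σ τ (∀' T)   =
  cong ∀' (trans (subTy-subTy (extS σ) (extS τ) T) (subTy-cong (subTy-extS σ τ) T))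
subTy-subTy σ τ (S ∧ T)  = cong₂ _∧_ (subTy-subTy σ τ S) (subTy-subTy σ τ T)

extS-tvar : extS tvar ≗ tvar
extS-tvar zero    = refl
extS-tvar (suc n) = refl

subTy-id : ∀ T → subTy tvar T ≣ T
subTy-id ⊤'       = refl
subTy-id (tvar n) = refl
subTy-id (S ⇒ T)  = cong₂ _⇒_ (subTy-id S) (subTy-id T)
subTy-id (∀' T)   = cong ∀' (trans (subTy-cong extS-tvar T) (subTy-id T))
subTy-id (S ∧ T)  = cong₂ _∧_ (subTy-id S) (subTy-id T)

extS-tvar∘ : ∀ ρ → extS (tvar ∘ ρ) ≗ tvar ∘ extR ρ
extS-tvar∘ ρ zero    = refl
extS-tvar∘ ρ (suc n) = refl

subTy-tvar∘ : ∀ ρ T → subTy (tvar ∘ ρ) T ≣ renTy ρ T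
subTy-tvar∘ ρ ⊤'       = refl
subTy-tvar∘ ρ (tvar n) = refl
subTy-tvar∘ ρ (S ⇒ T)  = cong₂ _⇒_ (subTy-tvar∘ ρ S) (subTy-tvar∘ ρ T)
subTy-tvar∘ ρ (∀' T)   = cong ∀' (trans (subTy-cong (extS-tvar∘ ρ) T) (subTy-tvar∘ (extR ρ) T))
subTy-tvar∘ ρ (S ∧ T)  = cong₂ _∧_ (subTy-tvar∘ ρ S) (subTy-tvar∘ ρ T)

[]ᵀ-wkTy : ∀ a U → wkTy U [ a ]ᵀ ≣ U
[]ᵀ-wkTy a U = trans (subTy-•-wkTy a tvar U) (subTy-id U)

subTy-[]ᵀ : ∀ σ T R → subTy σ (T [ R ]ᵀ) ≣ subTy (extS σ) T [ subTy σ R ]ᵀ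
subTy-[]ᵀ σ T R = trans (subTy-subTy σ (R • tvar) T)
  (sym (trans (subTy-subTy (subTy σ R • tvar) (extS σ) T) (subTy-cong pointwise T)))
  where
  pointwise : subTy (subTy σ R • tvar) ∘ extS σ ≗ subTy σ ∘ (R • tvar)
  pointwise zero    = refl
  pointwise (suc n) = []ᵀ-wkTy (subTy σ R) (σ n)

subTmTy-cong : ∀ {σ σ'} → σ ≗ σ' → subTmTy σ ≗ subTmTy σ'
subTmTy-cong eq top        = refl
subTmTy-cong eq (var n)    = refl
subTmTy-cong eq (lam T t)  = cong₂ lam (subTy-cong eq T) (subTmTy-cong eq t)
subTmTy-cong eq (Lam t)    = cong Lam (subTmTy-cong (extS-cong eq) t)
subTmTy-cong eq (app t s)  = cong₂ app (subTmTy-cong eq t) (subTmTy-cong eq s)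
subTmTy-cong eq (tapp t T) = cong₂ tapp (subTmTy-cong eq t) (subTy-cong eq T)

subTmTy-subTmTy : ∀ σ τ t → subTmTy σ (subTmTy τ t) ≣ subTmTy (subTy σ ∘ τ) t
subTmTy-subTmTy σ τ top        = refl
subTmTy-subTmTy σ τ (var n)    = refl
subTmTy-subTmTy σ τ (lam T t)  = cong₂ lam (subTy-subTy σ τ T) (subTmTy-subTmTy σ τ t)
subTmTy-subTmTy σ τ (Lam t)    =
  cong Lam (trans (subTmTy-subTmTy (extS σ) (extS τ) t) (subTmTy-cong (subTy-extS σ τ) t))
subTmTy-subTmTy σ τ (app t s)  = cong₂ app (subTmTy-subTmTy σ τ t) (subTmTy-subTmTy σ τ s)
subTmTy-subTmTy σ τ (tapp t T) = cong₂ tapp (subTmTy-subTmTy σ τ t) (subTy-subTy σ τ T)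

subTm-renTm-cancel : ∀ σ ρ → σ ∘ ρ ≗ var → ∀ u → subTm σ (renTm ρ u) ≣ u
subTm-renTm-cancel σ ρ inv top        = refl
subTm-renTm-cancel σ ρ inv (var n)    = inv n
subTm-renTm-cancel σ ρ inv (lam T u)  = cong (lam T) (subTm-renTm-cancel (extTm σ) (extR ρ) inv' u)
  where
  inv' : extTm σ ∘ extR ρ ≗ var
  inv' zero    = refl
  inv' (suc n) = cong wkTm (inv n)
subTm-renTm-cancel σ ρ inv (Lam u)    =
  cong Lam (subTm-renTm-cancel (wkTmTy ∘ σ) ρ (cong wkTmTy ∘ inv) u)
subTm-renTm-cancel σ ρ inv (app t s)  =
  cong₂ app (subTm-renTm-cancel σ ρ inv t) (subTm-renTm-cancel σ ρ inv s)
subTm-renTm-cancel σ ρ inv (tapp t T) = cong (λ u → tapp u T) (subTm-renTm-cancel σ ρ inv t)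

-- Renaming and substitution of judgements

TyVarRenaming : Ctx → Ctx → (ℕ → ℕ) → Set
TyVarRenaming Γ Δ ρ = ∀ {n U} → Γ ∋tv n <: U → Δ ∋tv ρ n <: renTy ρ U

TyVarRenaming-ext : ∀ {Γ Δ ρ} → TyVarRenaming Γ Δ ρ → TyVarRenaming (Γ ,<: ⊤') (Δ ,<: ⊤') (extR ρ)
TyVarRenaming-ext ren here = here
TyVarRenaming-ext {ρ = ρ} ren (thereTV {T = U} p) =
  subst (_ ∋tv _ <:_) (sym (renTy-extR-wkTy ρ U)) (thereTV (ren p))

<:-rename : ∀ {Γ Δ ρ A B} → TyVarRenaming Γ Δ ρ → Γ ⊢ A <: B → Δ ⊢ renTy ρ A <: renTy ρ B
<:-rename ren (S-var p)     = S-var (ren p)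
<:-rename ren S-top         = S-top
<:-rename ren S-refl        = S-refl
<:-rename ren (S-trans d e) = S-trans (<:-rename ren d) (<:-rename ren e)
<:-rename ren (S-⇒ d e)     = S-⇒ (<:-rename ren d) (<:-rename ren e)
<:-rename ren (S-∀ d)       = S-∀ (<:-rename (TyVarRenaming-ext ren) d)
<:-rename ren S-∧l          = S-∧l
<:-rename ren S-∧r          = S-∧r
<:-rename ren (S-∧ d e)     = S-∧ (<:-rename ren d) (<:-rename ren e)

wf-rename : ∀ {Γ Δ ρ A} → TyVarRenaming Γ Δ ρ → Γ ⊢wf A → Δ ⊢wf renTy ρ A
wf-rename ren wf-top           = wf-top
wf-rename ren (wf-var (U , p)) = wf-var (_ , ren p)
wf-rename ren (wf-⇒ a b)       = wf-⇒ (wf-rename ren a) (wf-rename ren b)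
wf-rename ren (wf-∀ a)         = wf-∀ (wf-rename (TyVarRenaming-ext ren) a)
wf-rename ren (wf-∧ a b)       = wf-∧ (wf-rename ren a) (wf-rename ren b)

<:-weaken : ∀ {Δ A B C} → Δ ⊢ A <: B → (Δ ,<: C) ⊢ wkTy A <: wkTy B
<:-weaken = <:-rename thereTV

wf-weaken : ∀ {Δ A C} → Δ ⊢wf A → (Δ ,<: C) ⊢wf wkTy A
wf-weaken = wf-rename thereTV

TyVarInclusion : Ctx → Ctx → Set
TyVarInclusion Γ Δ = ∀ {n U} → Γ ∋tv n <: U → Δ ∋tv n <: U

TyVarInclusion-ext : ∀ {Γ Δ C} → TyVarInclusion Γ Δ → TyVarInclusion (Γ ,<: C) (Δ ,<: C)
TyVarInclusion-ext inc here        = here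
TyVarInclusion-ext inc (thereTV p) = thereTV (inc p)

<:-mono : ∀ {Γ Δ A B} → TyVarInclusion Γ Δ → Γ ⊢ A <: B → Δ ⊢ A <: B
<:-mono inc (S-var p)     = S-var (inc p)
<:-mono inc S-top         = S-top
<:-mono inc S-refl        = S-refl
<:-mono inc (S-trans d e) = S-trans (<:-mono inc d) (<:-mono inc e)
<:-mono inc (S-⇒ d e)     = S-⇒ (<:-mono inc d) (<:-mono inc e)
<:-mono inc (S-∀ d)       = S-∀ (<:-mono (TyVarInclusion-ext inc) d)
<:-mono inc S-∧l          = S-∧l
<:-mono inc S-∧r          = S-∧r
<:-mono inc (S-∧ d e)     = S-∧ (<:-mono inc d) (<:-mono inc e)

wf-mono : ∀ {Γ Δ A} → TyVarInclusion Γ Δ → Γ ⊢wf A → Δ ⊢wf A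
wf-mono inc wf-top           = wf-top
wf-mono inc (wf-var (U , p)) = wf-var (_ , inc p)
wf-mono inc (wf-⇒ a b)       = wf-⇒ (wf-mono inc a) (wf-mono inc b)
wf-mono inc (wf-∀ a)         = wf-∀ (wf-mono (TyVarInclusion-ext inc) a)
wf-mono inc (wf-∧ a b)       = wf-∧ (wf-mono inc a) (wf-mono inc b)

RespectsBounds : Ctx → Ctx → (ℕ → Ty) → Set
RespectsBounds Γ Δ σ = ∀ {n U} → Γ ∋tv n <: U → Δ ⊢ σ n <: subTy σ U

RespectsBounds-ext : ∀ {Γ Δ σ} → RespectsBounds Γ Δ σ →
                     RespectsBounds (Γ ,<: ⊤') (Δ ,<: ⊤') (extS σ)
RespectsBounds-ext bounds here = S-top
RespectsBounds-ext {σ = σ} bounds (thereTV {T = U} p) =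
  subst (_ ⊢ _ <:_) (sym (subTy-extS-wkTy σ U)) (<:-weaken (bounds p))

<:-subst : ∀ {Γ Δ σ A B} → RespectsBounds Γ Δ σ → Γ ⊢ A <: B → Δ ⊢ subTy σ A <: subTy σ B
<:-subst bounds (S-var p)     = bounds p
<:-subst bounds S-top         = S-top
<:-subst bounds S-refl        = S-refl
<:-subst bounds (S-trans d e) = S-trans (<:-subst bounds d) (<:-subst bounds e)
<:-subst bounds (S-⇒ d e)     = S-⇒ (<:-subst bounds d) (<:-subst bounds e)
<:-subst bounds (S-∀ d)       = S-∀ (<:-subst (RespectsBounds-ext bounds) d)
<:-subst bounds S-∧l          = S-∧l
<:-subst bounds S-∧r          = S-∧r
<:-subst bounds (S-∧ d e)     = S-∧ (<:-subst bounds d) (<:-subst bounds e)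

RespectsWf : Ctx → Ctx → (ℕ → Ty) → Set
RespectsWf Γ Δ σ = ∀ {n U} → Γ ∋tv n <: U → Δ ⊢wf σ n

RespectsWf-ext : ∀ {Γ Δ σ} → RespectsWf Γ Δ σ → RespectsWf (Γ ,<: ⊤') (Δ ,<: ⊤') (extS σ)
RespectsWf-ext wf here        = wf-var (_ , here)
RespectsWf-ext wf (thereTV p) = wf-weaken (wf p)

wf-subst : ∀ {Γ Δ σ A} → RespectsWf Γ Δ σ → Γ ⊢wf A → Δ ⊢wf subTy σ A
wf-subst wf wf-top           = wf-top
wf-subst wf (wf-var (U , p)) = wf p
wf-subst wf (wf-⇒ a b)       = wf-⇒ (wf-subst wf a) (wf-subst wf b)
wf-subst wf (wf-∀ a)         = wf-∀ (wf-subst (RespectsWf-ext wf) a)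
wf-subst wf (wf-∧ a b)       = wf-∧ (wf-subst wf a) (wf-subst wf b)

-- A term variable may get a smaller type in Δ than the substituted one, so that the
-- domain of a λ can be narrowed when going under it.
record TypeSubst (Γ Δ : Ctx) (σ : ℕ → Ty) : Set where
  field
    bounds : RespectsBounds Γ Δ σ
    wf     : RespectsWf Γ Δ σ
    vars   : ∀ {n A} → Γ ∋v n ∶ A → Σ[ B ∈ Ty ] (Δ ∋v n ∶ B) × (Δ ⊢ B <: subTy σ A)
open TypeSubst

TypeSubst-extTyVar : ∀ {Γ Δ σ} → TypeSubst Γ Δ σ → TypeSubst (Γ ,<: ⊤') (Δ ,<: ⊤') (extS σ)
bounds (TypeSubst-extTyVar θ) = RespectsBounds-ext (bounds θ)
wf     (TypeSubst-extTyVar θ) = RespectsWf-ext (wf θ)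
vars   (TypeSubst-extTyVar {σ = σ} θ) (thereTV {T = A} p) with vars θ p
... | B , q , B<:σA =
  wkTy B , thereTV q , subst (_ ⊢ _ <:_) (sym (subTy-extS-wkTy σ A)) (<:-weaken B<:σA)

TypeSubst-extVar : ∀ {Γ Δ σ A C} → TypeSubst Γ Δ σ → Δ ⊢ C <: subTy σ A →
                   TypeSubst (Γ ,∶ A) (Δ ,∶ C) σ
bounds (TypeSubst-extVar θ C<:σA) (thereV p) = <:-mono thereV (bounds θ p)
wf     (TypeSubst-extVar θ C<:σA) (thereV p) = wf-mono thereV (wf θ p)
vars   (TypeSubst-extVar {C = C} θ C<:σA) here = C , here , <:-mono thereV C<:σA
vars   (TypeSubst-extVar θ C<:σA) (thereV p) with vars θ p
... | B , q , B<:σA = B , thereV q , <:-mono thereV B<:σA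

⊢-subst : ∀ {Γ Δ σ t A} → TypeSubst Γ Δ σ → Γ ⊢ t ∶ A → Δ ⊢ subTmTy σ t ∶ subTy σ A
⊢-subst θ T-top          = T-top
⊢-subst θ (T-var p) with vars θ p
... | B , q , B<:σA       = T-sub (T-var q) B<:σA
⊢-subst θ (T-sub d A<:B) = T-sub (⊢-subst θ d) (<:-subst (bounds θ) A<:B)
⊢-subst θ (T-lam d)      = T-lam (⊢-subst (TypeSubst-extVar θ S-refl) d)
⊢-subst θ (T-app d e)    = T-app (⊢-subst θ d) (⊢-subst θ e)
⊢-subst θ (T-Lam d)      = T-Lam (⊢-subst (TypeSubst-extTyVar θ) d)
⊢-subst {σ = σ} θ (T-tapp {T = T} {S' = R} d w) =
  subst (_ ⊢ _ ∶_) (sym (subTy-[]ᵀ σ T R)) (T-tapp (⊢-subst θ d) (wf-subst (wf θ) w))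

VarRenaming : Ctx → Ctx → (ℕ → ℕ) → Set
VarRenaming Γ Δ ρ = ∀ {n B} → Γ ∋v n ∶ B → Δ ∋v ρ n ∶ B

⊢-renTm : ∀ {Γ Δ ρ t A} → VarRenaming Γ Δ ρ → TyVarInclusion Γ Δ →
          Γ ⊢ t ∶ A → Δ ⊢ renTm ρ t ∶ A
⊢-renTm ren inc T-top          = T-top
⊢-renTm ren inc (T-var p)      = T-var (ren p)
⊢-renTm ren inc (T-sub d A<:B) = T-sub (⊢-renTm ren inc d) (<:-mono inc A<:B)
⊢-renTm {Γ} {Δ} {ρ} ren inc (T-lam {S = S} d) = T-lam (⊢-renTm ren' inc' d)
  where
  ren' : VarRenaming (Γ ,∶ S) (Δ ,∶ S) (extR ρ)
  ren' here       = here
  ren' (thereV p) = thereV (ren p)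
  inc' : TyVarInclusion (Γ ,∶ S) (Δ ,∶ S)
  inc' (thereV p) = thereV (inc p)
⊢-renTm ren inc (T-app d e)    = T-app (⊢-renTm ren inc d) (⊢-renTm ren inc e)
⊢-renTm {Γ} {Δ} {ρ} ren inc (T-Lam d) = T-Lam (⊢-renTm ren' (TyVarInclusion-ext inc) d)
  where
  ren' : VarRenaming (Γ ,<: ⊤') (Δ ,<: ⊤') ρ
  ren' (thereTV p) = thereTV (ren p)
⊢-renTm ren inc (T-tapp d w)   = T-tapp (⊢-renTm ren inc d) (wf-mono inc w)

-- Substituting mutually-subtype types

≡-subsume : ∀ {Θ t t' S T} → Θ ⊢ t ∶ S → Θ ⊢ t' ∶ S → Θ ⊢ t ≡ t' ∶ S → Θ ⊢ S <: T →
            Θ ⊢ t ≡ t' ∶ T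
≡-subsume {Θ} {S = S} {T} ⊢t ⊢t' t≡t' S<:T =
  E-trans (E-sym (E-β₁ (T-var here) (T-sub ⊢t S<:T)))
          (E-trans (E-app (E-refl ⊢id) t≡t') (E-β₁ (T-var here) (T-sub ⊢t' S<:T)))
  where
  ⊢id : Θ ⊢ lam T (var zero) ∶ (S ⇒ T)
  ⊢id = T-sub (T-lam (T-var here)) (S-⇒ S<:T S-refl)

lam-narrow : ∀ {Δ A A' B b} → (Δ ,∶ A) ⊢ b ∶ B → Δ ⊢ A' <: A →
             Δ ⊢ lam A b ≡ lam A' b ∶ (A' ⇒ B)
lam-narrow {Δ} {A} {A'} {B} {b} ⊢b A'<:A =
  E-trans (E-sym (E-η₁ (T-sub (T-lam ⊢b) (S-⇒ A'<:A S-refl)))) (E-lam β)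
  where
  ren : VarRenaming (Δ ,∶ A) (Δ ,∶ A' ,∶ A) (extR suc)
  ren here       = here
  ren (thereV p) = thereV (thereV p)
  inc : TyVarInclusion (Δ ,∶ A) (Δ ,∶ A' ,∶ A)
  inc (thereV p) = thereV (thereV p)
  cancel : (var zero • var) ∘ extR suc ≗ var
  cancel zero    = refl
  cancel (suc n) = refl
  β : (Δ ,∶ A') ⊢ app (wkTm (lam A b)) (var zero) ≡ b ∶ B
  β = subst ((Δ ,∶ A') ⊢ app (wkTm (lam A b)) (var zero) ≡_∶ B) (subTm-renTm-cancel (var zero • var) (extR suc) cancel b)
            (E-β₁ (⊢-renTm ren inc ⊢b) (T-sub (T-var here) (<:-mono thereV A'<:A)))

SubstLe : Ctx → (ℕ → Ty) → (ℕ → Ty) → Set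
SubstLe Δ σ τ = ∀ n → Δ ⊢ σ n <: τ n

SubstLe-ext : ∀ {Δ σ τ} → SubstLe Δ σ τ → SubstLe (Δ ,<: ⊤') (extS σ) (extS τ)
SubstLe-ext σ≤τ zero    = S-refl
SubstLe-ext σ≤τ (suc n) = <:-weaken (σ≤τ n)

SubstLe-mono : ∀ {Δ Δ' σ τ} → TyVarInclusion Δ Δ' → SubstLe Δ σ τ → SubstLe Δ' σ τ
SubstLe-mono inc σ≤τ = <:-mono inc ∘ σ≤τ

SubstLe-single : ∀ {Δ A B} → Δ ⊢ A <: B → SubstLe Δ (A • tvar) (B • tvar)
SubstLe-single A<:B zero    = A<:B
SubstLe-single A<:B (suc n) = S-refl

subTy-<: : ∀ {Δ σ τ} → SubstLe Δ σ τ → SubstLe Δ τ σ → ∀ A → Δ ⊢ subTy σ A <: subTy τ A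
subTy-<: σ≤τ τ≤σ ⊤'       = S-refl
subTy-<: σ≤τ τ≤σ (tvar n) = σ≤τ n
subTy-<: σ≤τ τ≤σ (S ⇒ T)  = S-⇒ (subTy-<: τ≤σ σ≤τ S) (subTy-<: σ≤τ τ≤σ T)
subTy-<: σ≤τ τ≤σ (∀' T)   = S-∀ (subTy-<: (SubstLe-ext σ≤τ) (SubstLe-ext τ≤σ) T)
subTy-<: σ≤τ τ≤σ (S ∧ T)  =
  S-∧ (S-trans S-∧l (subTy-<: σ≤τ τ≤σ S)) (S-trans S-∧r (subTy-<: σ≤τ τ≤σ T))

[]ᵀ-<: : ∀ {Δ A B} → Δ ⊢ A <: B → Δ ⊢ B <: A → ∀ T → Δ ⊢ (T [ A ]ᵀ) <: (T [ B ]ᵀ)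
[]ᵀ-<: A<:B B<:A = subTy-<: (SubstLe-single A<:B) (SubstLe-single B<:A)

subTmTy-≡ : ∀ {Γ Δ σ τ t A} → TypeSubst Γ Δ σ → TypeSubst Γ Δ τ →
            SubstLe Δ σ τ → SubstLe Δ τ σ →
            Γ ⊢ t ∶ A → Δ ⊢ subTmTy σ t ≡ subTmTy τ t ∶ subTy τ A
subTmTy-≡ θσ θτ σ≤τ τ≤σ T-top     = E-top T-top T-top
subTmTy-≡ θσ θτ σ≤τ τ≤σ (T-var p) = E-refl (⊢-subst θτ (T-var p))
subTmTy-≡ θσ θτ σ≤τ τ≤σ (T-sub {S = A} d A<:B) =
  ≡-subsume (T-sub (⊢-subst θσ d) (subTy-<: σ≤τ τ≤σ A)) (⊢-subst θτ d)
            (subTmTy-≡ θσ θτ σ≤τ τ≤σ d) (<:-subst (bounds θτ) A<:B)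
subTmTy-≡ {Δ = Δ} {σ} {τ} θσ θτ σ≤τ τ≤σ (T-lam {S = A} {T = B} d) =
  E-trans (lam-narrow ⊢σbody τA<:σA) (E-lam σbody≡τbody)
  where
  τA<:σA : Δ ⊢ subTy τ A <: subTy σ A
  τA<:σA = subTy-<: τ≤σ σ≤τ A
  ⊢σbody : (Δ ,∶ subTy σ A) ⊢ _ ∶ subTy τ B
  ⊢σbody = T-sub (⊢-subst (TypeSubst-extVar θσ S-refl) d) (<:-mono thereV (subTy-<: σ≤τ τ≤σ B))
  σbody≡τbody : (Δ ,∶ subTy τ A) ⊢ _ ≡ _ ∶ subTy τ B
  σbody≡τbody = subTmTy-≡ (TypeSubst-extVar θσ τA<:σA) (TypeSubst-extVar θτ S-refl)
                          (SubstLe-mono thereV σ≤τ) (SubstLe-mono thereV τ≤σ) d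
subTmTy-≡ θσ θτ σ≤τ τ≤σ (T-app d e) =
  E-app (subTmTy-≡ θσ θτ σ≤τ τ≤σ d) (subTmTy-≡ θσ θτ σ≤τ τ≤σ e)
subTmTy-≡ θσ θτ σ≤τ τ≤σ (T-Lam d) =
  E-Lam (subTmTy-≡ (TypeSubst-extTyVar θσ) (TypeSubst-extTyVar θτ)
                   (SubstLe-ext σ≤τ) (SubstLe-ext τ≤σ) d)
subTmTy-≡ {τ = τ} θσ θτ σ≤τ τ≤σ (T-tapp {T = T} {S' = R} d w) =
  subst (_ ⊢ _ ≡ _ ∶_) (sym (subTy-[]ᵀ τ T R))
    (E-app₂ (subTmTy-≡ θσ θτ σ≤τ τ≤σ d) (wf-subst (wf θσ) w) (wf-subst (wf θτ) w)
            ([]ᵀ-<: (subTy-<: σ≤τ τ≤σ R) (subTy-<: τ≤σ σ≤τ R) (subTy (extS τ) T)) S-refl)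

-- The substitution [X ∧ S / X]

meetSubst : Ty → ℕ → Ty
meetSubst S = (tvar zero ∧ wkTy S) • (tvar ∘ suc)

subTy-meetSubst-wkTy : ∀ S U → subTy (meetSubst S) (wkTy U) ≣ wkTy U
subTy-meetSubst-wkTy S U = trans (subTy-•-wkTy _ _ U) (subTy-tvar∘ suc U)

TypeSubst-meet : ∀ {Θ S} → Θ ⊢wf S → TypeSubst (Θ ,<: S) (Θ ,<: ⊤') (meetSubst S)
bounds (TypeSubst-meet {S = S} ⊢S) here =
  subst (_ ⊢ tvar zero ∧ wkTy S <:_) (sym (subTy-meetSubst-wkTy S S)) S-∧r
bounds (TypeSubst-meet {S = S} ⊢S) (thereTV {T = U} p) =
  subst (_ ⊢ _ <:_) (sym (subTy-meetSubst-wkTy S U)) (S-var (thereTV p))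
wf     (TypeSubst-meet ⊢S) here        = wf-∧ (wf-var (_ , here)) (wf-weaken ⊢S)
wf     (TypeSubst-meet ⊢S) (thereTV p) = wf-var (_ , thereTV p)
vars   (TypeSubst-meet {S = S} ⊢S) (thereTV {T = A} p) =
  wkTy A , thereTV p , subst (_ ⊢ _ <:_) (sym (subTy-meetSubst-wkTy S A)) S-refl

TypeSubst-single : ∀ {Θ S a} → Θ ⊢ a <: S → Θ ⊢wf a → TypeSubst (Θ ,<: S) Θ (a • tvar)
bounds (TypeSubst-single {S = S} {a} a<:S ⊢a) here =
  subst (_ ⊢ _ <:_) (sym ([]ᵀ-wkTy a S)) a<:S
bounds (TypeSubst-single {a = a} a<:S ⊢a) (thereTV {T = U} p) =
  subst (_ ⊢ _ <:_) (sym ([]ᵀ-wkTy a U)) (S-var p)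
wf     (TypeSubst-single a<:S ⊢a) here        = ⊢a
wf     (TypeSubst-single a<:S ⊢a) (thereTV p) = wf-var (_ , p)
vars   (TypeSubst-single {a = a} a<:S ⊢a) (thereTV {T = A} p) =
  A , p , subst (_ ⊢ _ <:_) (sym ([]ᵀ-wkTy a A)) S-refl

[]ᵀ-meetSubst : ∀ S S' → subTy (S' • tvar) ∘ meetSubst S ≗ (S' ∧ S) • tvar
[]ᵀ-meetSubst S S' zero    = cong (S' ∧_) ([]ᵀ-wkTy S' S)
[]ᵀ-meetSubst S S' (suc n) = refl

[X∧S/X]-[]ᵀ : ∀ S S' T → subTy (meetSubst S) T [ S' ]ᵀ ≣ T [ S' ∧ S ]ᵀ
[X∧S/X]-[]ᵀ S S' T = trans (subTy-subTy _ (meetSubst S) T) (subTy-cong ([]ᵀ-meetSubst S S') T)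

[X∧S/X]-[]ᵗᵀ : ∀ S S' t → (t [X∧ S /X]) [ S' ]ᵗᵀ ≣ t [ S' ∧ S ]ᵗᵀ
[X∧S/X]-[]ᵗᵀ S S' t =
  trans (subTmTy-subTmTy _ (meetSubst S) t) (subTmTy-cong ([]ᵀ-meetSubst S S') t)

⊢Λ[X∧S/X]-tapp : ∀ {Θ S S' T t} → (Θ ,<: S) ⊢ t ∶ T → Θ ⊢wf S → Θ ⊢wf S' →
                 Θ ⊢ tapp (Lam (t [X∧ S /X])) S' ∶ (T [ S' ∧ S ]ᵀ)
⊢Λ[X∧S/X]-tapp {S = S} {S'} {T} ⊢t ⊢S ⊢S' =
  subst (_ ⊢ _ ∶_) ([X∧S/X]-[]ᵀ S S' T) (T-tapp (T-Lam (⊢-subst (TypeSubst-meet ⊢S) ⊢t)) ⊢S')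

β-[X∧S/X] : ∀ {Θ S S' T t} → (Θ ,<: S) ⊢ t ∶ T → Θ ⊢wf S → Θ ⊢wf S' →
            Θ ⊢ tapp (Lam (t [X∧ S /X])) S' ≡ (t [ S' ∧ S ]ᵗᵀ) ∶ (T [ S' ∧ S ]ᵀ)
β-[X∧S/X] {Θ} {S} {S'} {T} {t} ⊢t ⊢S ⊢S' =
  subst₂ (Θ ⊢ tapp (Lam (t [X∧ S /X])) S' ≡_∶_) ([X∧S/X]-[]ᵗᵀ S S' t) ([X∧S/X]-[]ᵀ S S' T)
         (E-β₂ (⊢-subst (TypeSubst-meet ⊢S) ⊢t) ⊢S')

mainTheorem6 : (Θ : Ctx) (S S' T : Ty) (t : Tm) →
    (Θ ,<: S) ⊢ t ∶ T →
    Θ ⊢ S' <: S →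
    Θ ⊢wf S →
    Θ ⊢wf S' →
    Θ ⊢ tapp (Lam (t [X∧ S /X])) S' ≡ (t [ S' ]ᵗᵀ) ∶ (T [ S' ]ᵀ)
mainTheorem6 Θ S S' T t ⊢t S'<:S ⊢S ⊢S' =
  E-trans (≡-subsume (⊢Λ[X∧S/X]-tapp ⊢t ⊢S ⊢S') (⊢-subst θ∧ ⊢t) (β-[X∧S/X] ⊢t ⊢S ⊢S')
                     ([]ᵀ-<: S'∧S<:S' S'<:S'∧S T))
          (subTmTy-≡ θ∧ θ (SubstLe-single S'∧S<:S') (SubstLe-single S'<:S'∧S) ⊢t)
  where
  S'∧S<:S' : Θ ⊢ (S' ∧ S) <: S'
  S'∧S<:S' = S-∧l
  S'<:S'∧S : Θ ⊢ S' <: (S' ∧ S)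
  S'<:S'∧S = S-∧ S-refl S'<:S
  θ∧ : TypeSubst (Θ ,<: S) Θ ((S' ∧ S) • tvar)
  θ∧ = TypeSubst-single S-∧r (wf-∧ ⊢S' ⊢S)
  θ : TypeSubst (Θ ,<: S) Θ (S' • tvar)
  θ = TypeSubst-single S'<:S ⊢S'
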